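{- A linked rectified monadic fograph has a dualizer if and only if it is consistent, i.e. there are no two distinct variables $x\neq y$, neither of which labels an existential binder, with $x\simeq y$.
   Context: A fograph is a cograph (no induced four-vertex path) with vertices labelled by variables (binders) or atoms (literals), at least one literal, where every $x$-binder's scope (smallest strong module with $\ge2$ vertices containing it; module: $M$ with $N(v)\setminus M=N(w)\setminus M$ for $v,w\in M$; strong: every module disjoint from, inside, or containing it) contains a literal and no other $x$-binder. Existential binder: adjacent to every other vertex of its scope. An $x$-binder binds the literals of its scope containing $x$; rectified: each $x$-binder is the only one and binds every $x$-literal. Monadic: predicate symbols unary, no function symbols, no constants $1,0$. Each predicate symbol $p$ has a dual $\bar p\neq p$, $\bar{\bar p}=p$. Linked fograph: some vertices partitioned into links, each two non-adjacent literals with dual predicate symbols, every literal labelled $1$ or in a link. A dualizer assigns to each variable labelling an existential binder a term so that for every link the two atoms become dual after simultaneous substitution. Variable equivalence $\simeq$ is the equivalence relation on variables generated by $x\simeq y$ for each link $\{px,\bar py\}$. -}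

module Defs where

open import Data.Nat using (ℕ; _≤_)
open import Data.Bool using (Bool; true; false)
open import Data.Fin using (Fin)
open import Data.Fin.Subset using (Subset; _∈_; _∉_; _⊆_; _∩_; ∣_∣; Empty)
open import Data.Maybe using (Maybe; just; nothing)
open import Data.Product using (Σ; ∃; ∃-syntax; _×_; _,_)
open import Data.Sum using (_⊎_)
open import Relation.Binary.PropositionalEquality using (_≡_; _≢_)
open import Relation.Nullary using (¬_)
open import Data.Empty using (⊥)

record Signature : Set₁ where
  field
    Pred       : Set
    dual       : Pred → Pred
    dual-invol : ∀ p → dual (dual p) ≡ p
    dual-neq   : ∀ p → dual p ≢ p

Var : Set
Var = ℕ

-- Monadic language: no function symbols, no constants 1,0, so terms are
-- variables and every atom is  p x  with p unary.
data Label (S : Signature) : Set where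
  bind : Var → Label S
  lit  : Signature.Pred S → Var → Label S

record Graph (n : ℕ) : Set where
  field
    E       : Fin n → Fin n → Bool
    E-sym   : ∀ v w → E v w ≡ E w v
    E-irr   : ∀ v → E v v ≡ false

module _ {n : ℕ} (G : Graph n) where
  open Graph G

  Edge : Fin n → Fin n → Set
  Edge v w = E v w ≡ true

  -- no induced P4  a - b - c - d
  IsCograph : Set
  IsCograph = ∀ a b c d → Edge a b → Edge b c → Edge c d →
              ¬ Edge a c → ¬ Edge b d → ¬ Edge a d → ⊥

  IsModule : Subset n → Set
  IsModule M = ∀ v w → v ∈ M → w ∈ M → ∀ u → u ∉ M → E v u ≡ E w u

  Disjoint : Subset n → Subset n → Set
  Disjoint M N = Empty (M ∩ N)

  IsStrongModule : Subset n → Set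
  IsStrongModule M = IsModule M ×
    (∀ N → IsModule N → Disjoint N M ⊎ N ⊆ M ⊎ M ⊆ N)

  IsScope : Fin n → Subset n → Set
  IsScope v S = IsStrongModule S × 2 ≤ ∣ S ∣ × v ∈ S ×
    (∀ S′ → IsStrongModule S′ → 2 ≤ ∣ S′ ∣ → v ∈ S′ → S ⊆ S′)

record Fograph (S : Signature) (n : ℕ) : Set where
  field
    graph     : Graph n
    cograph   : IsCograph graph
    label     : Fin n → Label S
    someLit   : ∃[ v ] ∃[ p ] ∃[ x ] label v ≡ lit p x
    scopeCond : ∀ v x → label v ≡ bind x →
      ∃[ Sc ] (IsScope graph v Sc
              × (∃[ w ] w ∈ Sc × ∃[ p ] ∃[ y ] label w ≡ lit p y)
              × (∀ w → w ∈ Sc → w ≢ v → label w ≢ bind x))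
  open Graph graph public

module _ {S : Signature} {n : ℕ} (F : Fograph S n) where
  open Fograph F

  IsExistentialBinder : Fin n → Set
  IsExistentialBinder v = (∃[ x ] label v ≡ bind x) ×
    (∀ Sc → IsScope graph v Sc → ∀ w → w ∈ Sc → w ≢ v → Edge graph v w)

  LabelsExistentialBinder : Var → Set
  LabelsExistentialBinder x =
    ∃[ v ] label v ≡ bind x × IsExistentialBinder v

  Binds : Fin n → Fin n → Set
  Binds v w = ∃[ x ] label v ≡ bind x ×
    ∃[ p ] label w ≡ lit p x ×
    (∀ Sc → IsScope graph v Sc → w ∈ Sc)

  Rectified : Set
  Rectified = ∀ v x → label v ≡ bind x →
    (∀ w → label w ≡ bind x → w ≡ v) ×
    (∀ w p → label w ≡ lit p x → Binds v w)

-- Linked fographs.  The links are given by a partner function: the link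
-- containing v is {v , w} when partner v ≡ just w; vertices with
-- partner nothing lie in no link.

record LinkedFograph (S : Signature) (n : ℕ) : Set₁ where
  open Signature S
  field
    fograph : Fograph S n
  open Fograph fograph
  field
    partner       : Fin n → Maybe (Fin n)
    partner-irr   : ∀ v w → partner v ≡ just w → v ≢ w
    partner-sym   : ∀ v w → partner v ≡ just w → partner w ≡ just v
    link-nonadj   : ∀ v w → partner v ≡ just w → ¬ Edge graph v w
    link-literals : ∀ v w → partner v ≡ just w →
      ∃[ p ] ∃[ x ] ∃[ y ] label v ≡ lit p x × label w ≡ lit (dual p) y
    -- every literal is in a link (no literal is labelled 1: monadic)
    lit-linked    : ∀ v p x → label v ≡ lit p x → partner v ≢ nothing
  open Fograph fograph public

module _ {S : Signature} {n : ℕ} (L : LinkedFograph S n) where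
  open Signature S
  open LinkedFograph L

  IsLinkAtoms : Pred → Var → Pred → Var → Set
  IsLinkAtoms p x q y = ∃[ v ] ∃[ w ] partner v ≡ just w ×
    label v ≡ lit p x × label w ≡ lit q y

  Atom : Set
  Atom = Pred × Var

  dualAtom : Atom → Atom
  dualAtom (p , t) = (dual p , t)

  -- A dualizer assigns a term (here: a variable) to each variable
  -- labelling an existential binder; it is represented by the induced
  -- simultaneous substitution σ, which is the identity on all other
  -- variables.
  IsDualizer : (Var → Var) → Set
  IsDualizer σ =
    (∀ x → ¬ LabelsExistentialBinder fograph x → σ x ≡ x) ×
    (∀ p x q y → IsLinkAtoms p x q y → (q , σ y) ≡ dualAtom (p , σ x))

  HasDualizer : Set
  HasDualizer = ∃[ σ ] IsDualizer σ

  data _≃_ : Var → Var → Set where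
    ≃-link  : ∀ p x q y → IsLinkAtoms p x q y → x ≃ y
    ≃-refl  : ∀ x → x ≃ x
    ≃-sym   : ∀ {x y} → x ≃ y → y ≃ x
    ≃-trans : ∀ {x y z} → x ≃ y → y ≃ z → x ≃ z

  Consistent : Set
  Consistent = ¬ (∃[ x ] ∃[ y ] x ≢ y ×
    ¬ LabelsExistentialBinder fograph x ×
    ¬ LabelsExistentialBinder fograph y × x ≃ y)

module Submission where

-- A dualizer σ identifies the two variables of every link, hence (by
-- induction on the generation of ≃) identifies ≃-equivalent variables;
-- since it fixes every variable not labelling an existential binder, two
-- such variables can be ≃-equivalent only if they are equal.
--
-- Conversely, we build σ by a union–find style computation that processes
-- the finitely many link pairs (x , y) one at a time.  The general part of
-- the file works for any equivalence relation R on a type with decidable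
-- equality, together with a decidable set of "rigid" points any two of
-- which are equal when R-related: merging the classes of a pair so that
-- rigid points are never moved preserves the invariant "σ fixes rigid
-- points and σ z R z", and later merges never separate earlier ones.

open import Defs
open import Data.Nat using (ℕ; _≟_)
open import Data.Fin using (Fin)
import Data.Fin as Fin
open import Data.Fin.Properties using (any?; all?)
import Data.Fin.Subset as Subset
open import Data.Fin.Subset.Properties using (_∈?_)
import Data.Bool as Bool
open import Data.Maybe using (just; nothing)
open import Data.Product using (∃-syntax; _×_; _,_; proj₁; proj₂)
open import Data.List using (List; []; _∷_; concatMap; allFin)
open import Data.List.Membership.Propositional using (_∈_; lose)
open import Data.List.Membership.Propositional.Properties
  using (∈-concatMap⁺; ∈-concatMap⁻; ∈-allFin)
open import Data.List.Relation.Unary.Any using (here; there; satisfied)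
open import Data.Empty using (⊥-elim)
open import Level using (0ℓ)
open import Function using (id; _∘′_)
open import Function.Bundles using (_⇔_; mk⇔)
open import Relation.Binary using (Rel; IsEquivalence; DecidableEquality)
open import Relation.Binary.PropositionalEquality
open import Relation.Nullary using (Dec; yes; no; ¬_; ¬?)
open import Relation.Nullary.Decidable using (_×-dec_; _→-dec_)

module Merging {A : Set} (_≟_ : DecidableEquality A)
  {R : Rel A 0ℓ} (R-equiv : IsEquivalence R)
  {Rigid : A → Set} (rigid? : ∀ x → Dec (Rigid x))
  (rigid-unique : ∀ {x y} → Rigid x → Rigid y → R x y → x ≡ y) where

  open IsEquivalence R-equiv renaming (refl to R-refl; sym to R-sym; trans to R-trans)

  Invariant : (A → A) → Set
  Invariant σ = (∀ x → Rigid x → σ x ≡ x) × (∀ z → R (σ z) z)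

  retarget : A → A → A → A
  retarget r t z with z ≟ r
  ... | yes _ = t
  ... | no  _ = z

  retarget-invariant : ∀ {σ r t} → R t r → (Rigid r → t ≡ r) →
    Invariant σ → Invariant (retarget r t ∘′ σ)
  retarget-invariant {σ} {r} {t} t∼r rigid-r (fixes , stays) =
    fixes′ , stays′
    where
    fixes′ : ∀ x → Rigid x → retarget r t (σ x) ≡ x
    fixes′ x rx with σ x ≟ r
    ... | no  _   = fixes x rx
    ... | yes σx≡r = trans (rigid-r (subst Rigid x≡r rx)) (sym x≡r)
      where x≡r = trans (sym (fixes x rx)) σx≡r
    stays′ : ∀ z → R (retarget r t (σ z)) z
    stays′ z with σ z ≟ r
    ... | yes refl = R-trans t∼r (stays z)
    ... | no  _    = stays z

  retarget-source : ∀ r t → retarget r t r ≡ t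
  retarget-source r t with r ≟ r
  ... | yes _  = refl
  ... | no r≢r = ⊥-elim (r≢r refl)

  retarget-target : ∀ r t → retarget r t t ≡ t
  retarget-target r t with t ≟ r
  ... | yes _ = refl
  ... | no  _ = refl

  merge : (A → A) → A → A → A → A
  merge σ a b with rigid? (σ a)
  ... | yes _ = retarget (σ b) (σ a) ∘′ σ
  ... | no  _ = retarget (σ a) (σ b) ∘′ σ

  merge-identifies : ∀ σ a b → merge σ a b a ≡ merge σ a b b
  merge-identifies σ a b with rigid? (σ a)
  ... | yes _ = trans (retarget-target (σ b) (σ a)) (sym (retarget-source (σ b) (σ a)))
  ... | no  _ = trans (retarget-source (σ a) (σ b)) (sym (retarget-target (σ a) (σ b)))

  -- merge post-composes σ with a function, so it keeps earlier identifications.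
  merge-preserves : ∀ σ a b {x y} → σ x ≡ σ y → merge σ a b x ≡ merge σ a b y
  merge-preserves σ a b e with rigid? (σ a)
  ... | yes _ = cong (retarget (σ b) (σ a)) e
  ... | no  _ = cong (retarget (σ a) (σ b)) e

  images-related : ∀ {σ a b} → Invariant σ → R a b → R (σ a) (σ b)
  images-related {a = a} {b} (_ , stays) a∼b =
    R-trans (stays a) (R-trans a∼b (R-sym (stays b)))

  -- If the image of a is rigid it is kept and, by rigid-unique, the image
  -- of b may move onto it; otherwise the image of a moves.
  merge-invariant : ∀ σ a b → R a b → Invariant σ → Invariant (merge σ a b)
  merge-invariant σ a b a∼b inv with rigid? (σ a)
  ... | yes rigid-σa =
    retarget-invariant (images-related inv a∼b)
      (λ rigid-σb → rigid-unique rigid-σa rigid-σb (images-related inv a∼b)) inv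
  ... | no ¬rigid-σa =
    retarget-invariant (R-sym (images-related inv a∼b))
      (λ rigid-σa → ⊥-elim (¬rigid-σa rigid-σa)) inv

  mergeAll : (A → A) → List (A × A) → A → A
  mergeAll σ []             = σ
  mergeAll σ ((a , b) ∷ ps) = mergeAll (merge σ a b) ps

  mergeAll-invariant : ∀ σ ps → (∀ {a b} → (a , b) ∈ ps → R a b) →
    Invariant σ → Invariant (mergeAll σ ps)
  mergeAll-invariant σ []             related inv = inv
  mergeAll-invariant σ ((a , b) ∷ ps) related inv =
    mergeAll-invariant (merge σ a b) ps (λ m → related (there m))
      (merge-invariant σ a b (related (here refl)) inv)

  mergeAll-preserves : ∀ σ ps {x y} → σ x ≡ σ y → mergeAll σ ps x ≡ mergeAll σ ps y
  mergeAll-preserves σ []             e = e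
  mergeAll-preserves σ ((a , b) ∷ ps) e = mergeAll-preserves (merge σ a b) ps (merge-preserves σ a b e)

  mergeAll-identifies : ∀ σ ps {a b} → (a , b) ∈ ps → mergeAll σ ps a ≡ mergeAll σ ps b
  mergeAll-identifies σ ((a , b) ∷ ps) (here refl) =
    mergeAll-preserves (merge σ a b) ps (merge-identifies σ a b)
  mergeAll-identifies σ ((c , d) ∷ ps) (there m) =
    mergeAll-identifies (merge σ c d) ps m

  identify : (ps : List (A × A)) → (∀ {a b} → (a , b) ∈ ps → R a b) →
    ∃[ σ ] (∀ x → Rigid x → σ x ≡ x) × (∀ {a b} → (a , b) ∈ ps → σ a ≡ σ b)
  identify ps related =
    mergeAll id ps ,
    proj₁ (mergeAll-invariant id ps related ((λ _ _ → refl) , λ _ → R-refl)) ,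
    mergeAll-identifies id ps

-- Scopes are unique (each is
-- contained in every other by minimality), so it suffices to test the
-- adjacency condition on the scope provided by the fograph axioms.
module ExistentialBinders {S : Signature} {n : ℕ} (F : Fograph S n) where
  open Fograph F

  AdjacentWithin : Subset.Subset n → Fin n → Set
  AdjacentWithin Sc v = ∀ w → w Subset.∈ Sc → w ≢ v → Edge graph v w

  adjacentWithin? : ∀ Sc v → Dec (AdjacentWithin Sc v)
  adjacentWithin? Sc v =
    all? λ w → (w ∈? Sc) →-dec ((¬? (w Fin.≟ v)) →-dec (E v w Bool.≟ Bool.true))

  scope-minimal : ∀ {v Sc Sc′} → IsScope graph v Sc → IsScope graph v Sc′ →
    Sc Subset.⊆ Sc′
  scope-minimal (_ , _ , _ , minimal) (strong′ , size′ , v∈′ , _) =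
    minimal _ strong′ size′ v∈′

  isExistentialBinder? : ∀ v → Dec (IsExistentialBinder F v)
  isExistentialBinder? v with label v in lv
  ... | lit _ _ = no λ { ((_ , ()) , _) }
  ... | bind x with scopeCond v x lv
  ...   | Sc , scope , _ with adjacentWithin? Sc v
  ...     | yes adjacent = yes ((x , refl) , λ Sc′ scope′ w w∈Sc′ w≢v →
              adjacent w (scope-minimal scope′ scope w∈Sc′) w≢v)
  ...     | no ¬adjacent = no λ (_ , existential) → ¬adjacent (existential Sc scope)

  labelsBinder? : ∀ (l : Label S) x → Dec (l ≡ bind x)
  labelsBinder? (lit _ _) x = no λ ()
  labelsBinder? (bind y)  x with y ≟ x
  ... | yes refl = yes refl
  ... | no  y≢x  = no λ { refl → y≢x refl }

  labelsExistentialBinder? : ∀ x → Dec (LabelsExistentialBinder F x)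
  labelsExistentialBinder? x =
    any? λ v → labelsBinder? (label v) x ×-dec isExistentialBinder? v

module _ {S : Signature} {n : ℕ} (L : LinkedFograph S n) where
  open Signature S
  open LinkedFograph L

  Universal : Var → Set
  Universal x = ¬ LabelsExistentialBinder fograph x

  -- A dualizer respects variable equivalence, since it identifies the
  -- variables of each link.
  dualizer-respects-≃ : ∀ {σ} → IsDualizer L σ → ∀ {x y} → _≃_ L x y → σ x ≡ σ y
  dualizer-respects-≃ (_ , dualizes) (≃-link p x q y link) =
    sym (cong proj₂ (dualizes p x q y link))
  dualizer-respects-≃ dualizer (≃-refl _)    = refl
  dualizer-respects-≃ dualizer (≃-sym r)     = sym (dualizer-respects-≃ dualizer r)
  dualizer-respects-≃ dualizer (≃-trans r s) =
    trans (dualizer-respects-≃ dualizer r) (dualizer-respects-≃ dualizer s)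

  dualizer⇒consistent : HasDualizer L → Consistent L
  dualizer⇒consistent (σ , dualizer@(fixes , _)) (x , y , x≢y , ux , uy , x≃y) =
    x≢y (begin
      x   ≡⟨ sym (fixes x ux) ⟩
      σ x ≡⟨ dualizer-respects-≃ dualizer x≃y ⟩
      σ y ≡⟨ fixes y uy ⟩
      y   ∎)
    where open ≡-Reasoning

  linkPairsAt : Fin n → List (Var × Var)
  linkPairsAt v with partner v
  ... | nothing = []
  ... | just w with label v | label w
  ...   | lit _ x | lit _ y = (x , y) ∷ []
  ...   | lit _ _ | bind _  = []
  ...   | bind _  | _       = []

  linkPairsAt-sound : ∀ v {x y} → (x , y) ∈ linkPairsAt v → _≃_ L x y
  linkPairsAt-sound v m with partner v in pv
  ... | just w with label v in lv | label w in lw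
  ...   | lit p x | lit q y with m
  ...     | here refl = ≃-link p x q y (v , w , pv , lv , lw)

  linkPairsAt-complete : ∀ {p x q y} → (link : IsLinkAtoms L p x q y) →
    (x , y) ∈ linkPairsAt (proj₁ link)
  linkPairsAt-complete (v , w , pv , lv , lw) with partner v | pv
  ... | just .w | refl with label v | lv | label w | lw
  ...   | lit _ _ | refl | lit _ _ | refl = here refl

  linkPairs : List (Var × Var)
  linkPairs = concatMap linkPairsAt (allFin n)

  linkPairs-sound : ∀ {x y} → (x , y) ∈ linkPairs → _≃_ L x y
  linkPairs-sound m with satisfied (∈-concatMap⁻ linkPairsAt {xs = allFin n} m)
  ... | v , m′ = linkPairsAt-sound v m′

  linkPairs-complete : ∀ {p x q y} → IsLinkAtoms L p x q y → (x , y) ∈ linkPairs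
  linkPairs-complete link@(v , _) =
    ∈-concatMap⁺ linkPairsAt (lose (∈-allFin v) (linkPairsAt-complete link))

  -- A map identifying the variables of each link and fixing the universal
  -- variables is a dualizer: the predicate symbols of a link are dual already.
  identifying⇒dualizer : ∀ σ → (∀ x → Universal x → σ x ≡ x) →
    (∀ {x y} → (x , y) ∈ linkPairs → σ x ≡ σ y) → IsDualizer L σ
  identifying⇒dualizer σ fixes identifies = fixes , dualizes
    where
    dualizes : ∀ p x q y → IsLinkAtoms L p x q y → (q , σ y) ≡ dualAtom L (p , σ x)
    dualizes p x q y link@(v , w , pv , lv , lw)
      with link-literals v w pv
    ... | _ , _ , _ , lv′ , lw′ with trans (sym lv) lv′ | trans (sym lw) lw′
    ... | refl | refl = cong (dual p ,_) (sym (identifies (linkPairs-complete link)))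

  -- For a consistent fograph the universal variables are rigid points of
  -- ≃, so the merging construction identifies all link pairs.
  linkIdentifier : Consistent L →
    ∃[ σ ] (∀ x → Universal x → σ x ≡ x) × (∀ {x y} → (x , y) ∈ linkPairs → σ x ≡ σ y)
  linkIdentifier consistent = identify linkPairs linkPairs-sound
    where
    universal-unique : ∀ {x y} → Universal x → Universal y → _≃_ L x y → x ≡ y
    universal-unique {x} {y} ux uy x≃y with x ≟ y
    ... | yes x≡y = x≡y
    ... | no  x≢y = ⊥-elim (consistent (x , y , x≢y , ux , uy , x≃y))
    equivalence : IsEquivalence (_≃_ L)
    equivalence = record { refl = ≃-refl _ ; sym = ≃-sym ; trans = ≃-trans }
    open ExistentialBinders fograph using (labelsExistentialBinder?)
    open Merging _≟_ equivalence (λ x → ¬? (labelsExistentialBinder? x))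
      universal-unique using (identify)

  consistent⇒dualizer : Consistent L → HasDualizer L
  consistent⇒dualizer consistent with linkIdentifier consistent
  ... | σ , fixes , identifies = σ , identifying⇒dualizer σ fixes identifies

mainTheorem16 : (S : Signature) (n : ℕ) (L : LinkedFograph S n) →
    Rectified (LinkedFograph.fograph L) →
    (HasDualizer L ⇔ Consistent L)
mainTheorem16 S n L _ = mk⇔ (dualizer⇒consistent L) (consistent⇒dualizer L)
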